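{- Let $p$ be a prime. Suppose $\lambda$ and $\mu$ are $p$-deprived partitions (of $n\ge0$ and $m\ge0$ respectively) having no part in common. Then $g_{\lambda\mu} = g_\lambda g_\mu$. Consequently, for every $p$-deprived partition $\lambda$, $$g_\lambda = \prod_{u \geq 1,\ p \nmid u} g_{(u)^{r_u(\lambda)}}.$$
   Context: A partition is a finite nonincreasing sequence of positive integers (parts); $\varnothing$ is the partition of $0$. A partition is $p$-deprived if none of its parts is divisible by $p$. $\lambda\mu$ is the partition whose parts are the union (with multiplicity) of the parts of $\lambda$ and $\mu$; $(u)^r$ is the partition with $r$ parts equal to $u$. $r_a(\mu)$ is the number of parts equal to $a$; $z_\mu=\prod_{a\ge1} a^{r_a(\mu)} r_a(\mu)!$; $(-1)^\mu = (-1)^{\sum_i(\mu_i-1)}$; $p_k=\sum_i x_i^k$ is the power-sum symmetric function and $p_\mu=\prod_i p_{\mu_i}$, $p_\varnothing=1$. A partition $\mu$ is a $p$-splitting of $\lambda$ if $\lambda$ has a part $pu$ ($u\ge1$) and $\mu$ is obtained by replacing one such part by $p$ parts equal to $u$; $p$-equivalence $\sim_p$ is the equivalence relation on partitions of a fixed integer generated by $p$-splitting. For a partition $\lambda$, $g_\lambda := \sum_{\mu\sim_p\lambda} (-1)^\mu p_\mu / z_\mu$, a symmetric function with rational coefficients. -}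

module Defs where

open import Data.Nat using (ℕ; zero; suc; _+_; _*_; _^_; _≥_; _≥?_; _<_; _≤_; NonZero; _≟_)
open import Data.Nat.Properties using (m*n≢0; m^n≢0; _!≢0)
open import Data.Nat using (_!)
open import Data.Nat.Divisibility using (_∣_; _∣?_)
open import Data.Integer using (+_)
open import Data.Rational using (ℚ; 0ℚ; 1ℚ; -_; _/_) renaming (_+_ to _+ℚ_; _*_ to _*ℚ_)
open import Data.Fin using (Fin)
open import Data.Nat.ListAction using (sum)
open import Data.List using (List; []; _∷_; _++_; map; foldr; length; filter; replicate; upTo)
open import Data.List.Relation.Unary.All using (All)
open import Data.List.Relation.Unary.Linked using (Linked)
open import Data.List.Relation.Unary.Unique.Propositional using (Unique)
open import Data.List.Relation.Binary.Permutation.Propositional using (_↭_)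
open import Data.List.Membership.Propositional using (_∈_; _∉_)
open import Data.Product using (Σ; ∃; _×_)
open import Relation.Nullary using (¬_; ¬?)
open import Relation.Binary.Construct.Closure.Equivalence using (EqClosure)

IsPartition : List ℕ → Set
IsPartition λ′ = All (λ a → 1 ≤ a) λ′ × Linked _≥_ λ′

Deprived : ℕ → List ℕ → Set
Deprived p λ′ = All (λ a → ¬ (p ∣ a)) λ′

NoCommonPart : List ℕ → List ℕ → Set
NoCommonPart λ′ μ = ∀ a → a ∈ λ′ → a ∉ μ

-- λμ : union of parts, as the nonincreasing merge
_⊕_ : List ℕ → List ℕ → List ℕ
λ′ ⊕ μ = Data.List.merge _≥?_ λ′ μ

r : ℕ → List ℕ → ℕ
r a μ = length (filter (a ≟_) μ)

rep : ℕ → ℕ → List ℕ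
rep u k = replicate k u

-- μ is a p-splitting of λ: λ has a part p*u (u ≥ 1) and μ is obtained by
-- replacing one such part by p parts equal to u (parts compared as multisets).
Split : ℕ → List ℕ → List ℕ → Set
Split p λ′ μ = IsPartition λ′ × IsPartition μ ×
  Σ ℕ (λ u → 1 ≤ u × Σ (List ℕ) (λ rest →
    (λ′ ↭ (p * u) ∷ rest) × (μ ↭ replicate p u ++ rest)))

_∼[_]_ : List ℕ → ℕ → List ℕ → Set
λ′ ∼[ p ] μ = EqClosure (Split p) λ′ μ

-- z_μ = ∏_{a ≥ 1} a^{r_a(μ)} r_a(μ)!   (only a ≤ |μ| can have r_a ≠ 0)

zFactors : List ℕ → List ℕ → ℕ
zFactors μ [] = 1
zFactors μ (a ∷ as) = (suc a ^ r (suc a) μ) * (r (suc a) μ !) * zFactors μ as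

zFactors≢0 : ∀ μ as → NonZero (zFactors μ as)
zFactors≢0 μ [] = _
zFactors≢0 μ (a ∷ as) =
  m*n≢0 ((suc a ^ r (suc a) μ) * (r (suc a) μ !)) (zFactors μ as)
    {{m*n≢0 (suc a ^ r (suc a) μ) (r (suc a) μ !) {{m^n≢0 (suc a) (r (suc a) μ)}} {{r (suc a) μ !≢0}}}}
    {{zFactors≢0 μ as}}

-- a ranges over 1 .. sum μ
z : List ℕ → ℕ
z μ = zFactors μ (upTo (sum μ))

instance
  z≢0 : ∀ {μ} → NonZero (z μ)
  z≢0 {μ} = zFactors≢0 μ (upTo (sum μ))

-- Evaluation at a point x ∈ ℚ^N (N variables x_0 … x_{N-1}).

powℚ : ℚ → ℕ → ℚ
powℚ q zero = 1ℚ
powℚ q (suc k) = q *ℚ powℚ q k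

sumFin : ∀ {N} → (Fin N → ℚ) → ℚ
sumFin {zero} f = 0ℚ
sumFin {suc N} f = f Fin.zero +ℚ sumFin (λ i → f (Fin.suc i))
  where import Data.Fin as Fin

pk : ∀ {N} → (Fin N → ℚ) → ℕ → ℚ
pk x k = sumFin (λ i → powℚ (x i) k)

pμ : ∀ {N} → (Fin N → ℚ) → List ℕ → ℚ
pμ x μ = foldr (λ a acc → pk x a *ℚ acc) 1ℚ μ

neg1^ : ℕ → ℚ
neg1^ zero = 1ℚ
neg1^ (suc k) = - neg1^ k

signμ : List ℕ → ℚ
signμ μ = neg1^ (sum (map Data.Nat.pred μ))

term : ∀ {N} → (Fin N → ℚ) → List ℕ → ℚ
term x μ = signμ μ *ℚ (pμ x μ *ℚ _/_ (+ 1) (z μ) {{z≢0 {μ}}})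

sumList : ∀ {N} → (Fin N → ℚ) → List (List ℕ) → ℚ
sumList x L = foldr (λ μ acc → term x μ +ℚ acc) 0ℚ L

-- The finite sum over the p-equivalence class of λ is taken along an
-- enumeration E λ of that class (duplicate-free, exactly the class).

EnumeratesClasses : ℕ → (List ℕ → List (List ℕ)) → Set
EnumeratesClasses p E = ∀ λ′ → IsPartition λ′ →
  Unique (E λ′) × (∀ μ → (μ ∈ E λ′ → λ′ ∼[ p ] μ) × (λ′ ∼[ p ] μ → μ ∈ E λ′))

g : (List ℕ → List (List ℕ)) → List ℕ → ∀ {N} → (Fin N → ℚ) → ℚ
g E λ′ x = sumList x (E λ′)

-- ∏_{u ≥ 1, p ∤ u} g_{(u)^{r_u(λ)}} evaluated at x; factors with u > |λ|
-- have r_u(λ) = 0, i.e. are g_∅, so u ranges over 1 .. |λ|.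
prodG : ℕ → (List ℕ → List (List ℕ)) → List ℕ → ∀ {N} → (Fin N → ℚ) → ℚ
prodG p E λ′ x =
  foldr (λ u acc → g E (rep u (r u λ′)) x *ℚ acc) 1ℚ
        (filter (λ u → ¬? (p ∣? u)) (map suc (upTo (sum λ′))))

{-# OPTIONS --safe #-}
module Submission where

-- For a > 0 let a° (pFreePart a) be a with every factor p divided out. A p-splitting replaces a
-- part p·u by p parts u, all with the same °-value. Hence, for any set F of numbers, "every part has
-- its °-value in F" is an invariant of a p-class, and deleting the parts whose °-value is not in F
-- maps p-equivalent partitions to p-equivalent ones. For p-deprived λ and μ without common part
-- take F = parts of λ: then ν ↦ (parts of ν with °-value in F, the other parts) is a bijection from
-- the class of λμ onto (class of λ) × (class of μ), inverse to merging. Partitions taken from the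
-- two classes share no part, so (-1)^ν, p_ν and z_ν are multiplicative along it, and
-- g_{λμ} = g_λ g_μ. The product formula follows by splitting off the parts equal to one u at a time.

-- Defs exports an instance z≢0 : NonZero (z μ) for every μ; in scope it leaves every other
-- NonZero instance search stuck on solving z ?μ = n, so it is hidden.
import Defs as D hiding (z≢0)
open D
open import Algebra.Bundles using (CommutativeMonoid)
open import Algebra.Core using (Op₂)
open import Algebra.Structures using (IsCommutativeMonoid)
open import Algebra.Properties.CommutativeSemigroup using (interchange)
open import Data.Empty using (⊥)
open import Data.Fin using (Fin)
open import Data.Integer using (+_)
open import Data.List
  using (List; []; _∷_; _++_; [_]; _∷ʳ_; map; foldr; filter; partition; replicate; length; upTo; cartesianProduct)
open import Data.List.Properties
  using (filter-++; filter-all; filter-none; filter-accept; filter-reject; foldr-map; map-++; upTo-∷ʳ; length-++;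
         partition-defn; ++-identityʳ; ++-assoc)
open import Data.List.Membership.Propositional using (_∈_; _∉_)
open import Data.List.Membership.Propositional.Properties
  using (∈-filter⁺; ∈-filter⁻; ∈-map⁺; ∈-map⁻; ∈-cartesianProduct⁺; ∈-cartesianProduct⁻; ∈-upTo⁺)
open import Data.List.Membership.Propositional.Properties.WithK using (unique∧set⇒bag)
open import Data.List.Relation.Binary.BagAndSetEquality using (∼bag⇒↭)
open import Data.List.Relation.Binary.Permutation.Propositional
  using (_↭_; ↭-sym; ↭-trans; ↭⇒↭ₛ; ↭ₛ⇒↭; module PermutationReasoning)
open import Data.List.Relation.Binary.Permutation.Propositional.Properties
  using (All-resp-↭; map⁺; filter-↭; merge-↭; ++-comm; ++⁺ʳ; ↭-length)
import Data.List.Relation.Binary.Permutation.Setoid.Properties as PermutationₛP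
open import Data.List.Relation.Binary.Pointwise using (Pointwise-≡⇒≡)
open import Data.List.Relation.Unary.All as All using (All; []; _∷_)
import Data.List.Relation.Unary.All.Properties as AllP
open import Data.List.Relation.Unary.AllPairs using ([]; _∷_)
open import Data.List.Relation.Unary.Any using (here; there)
open import Data.List.Relation.Unary.Linked using (Linked; [])
import Data.List.Relation.Unary.Linked.Properties as LinkedP
open import Data.List.Relation.Unary.Sorted.TotalOrder.Properties using (↗↭↗⇒≋; merge⁺)
open import Data.List.Relation.Unary.Unique.Propositional using (Unique)
import Data.List.Relation.Unary.Unique.Propositional.Properties as UniqueP
open import Data.Nat
  using (ℕ; zero; suc; _+_; _*_; _^_; _!; _≤_; _≥_; _≥?_; _≟_; s≤s; z≤n; pred; _/_;
         NonZero; NonTrivial; nonTrivial⇒nonZero; nonTrivial⇒n>1)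
open import Data.Nat.Properties
  using (≤-totalOrder; ≤-decTotalOrder; ≤-trans; ≤-pred; <⇒≱; m≤m+n; m≤n+m; m≤n*m; n≤1+n; +-comm;
         +-suc; +-identityʳ; *-identityʳ; *-identityˡ; *-assoc; *-comm; *-commutativeSemigroup; suc-injective; suc-pred)
open import Data.Nat.Coprimality using (1-coprimeTo)
open import Data.Nat.DivMod using (m*n/n≡m; m/n<m; 0/n≡0)
open import Data.Nat.Divisibility using (_∣_; _∣?_; m∣m*n)
open import Data.Nat.ListAction using (sum)
open import Data.Nat.ListAction.Properties using (sum-↭; sum-++)
open import Data.Nat.Primality using (Prime; prime)
open import Data.List.Membership.DecPropositional _≟_ using (_∈?_)
open import Data.Product using (_×_; _,_; proj₁; proj₂; uncurry)
open import Data.Rational using (ℚ; 1ℚ; -_; mkℚ) renaming (_+_ to _+ℚ_; _*_ to _*ℚ_; _/_ to _/ℚ_)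
import Data.Rational.Properties as ℚP
open import Data.Sum using (_⊎_; inj₁; inj₂)
open import Function using (_∘_; _⇔_; mk⇔; Equivalence; const)
open import Function.Properties.Equivalence using (⇔-isEquivalence)
import Relation.Binary.Construct.Closure.Equivalence as EqClosure
open import Relation.Binary.Construct.Closure.ReflexiveTransitive using (ε)
import Relation.Binary.Construct.Flip.EqAndOrd as Flip
import Relation.Binary.Construct.On as On
import Relation.Binary.Reasoning.Setoid as EqReasoning
import Relation.Binary.PropositionalEquality as ≡
open import Relation.Binary.PropositionalEquality
  using (_≡_; _≢_; refl; sym; trans; cong; cong₂; subst; module ≡-Reasoning)
open import Relation.Nullary using (¬_; ¬?; yes; no; contradiction)
open import Relation.Unary using (Decidable; ∁)
open import Relation.Unary.Properties using (∁?)

private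
  variable
    A A′ B : Set
    k n N u : ℕ
    a b xs ys ν λ′ μ : List ℕ

module CommutativeFold {_∙_ : Op₂ A} {e : A} (isCM : IsCommutativeMonoid _≡_ _∙_ e) where
  open IsCommutativeMonoid isCM using (assoc; identityˡ)

  fold : (B → A) → List B → A
  fold f = foldr (λ x acc → f x ∙ acc) e

  fold-map : (f : B → A) (h : A′ → B) (xs : List A′) → fold f (map h xs) ≡ fold (f ∘ h) xs
  fold-map f h xs = foldr-map (λ x acc → f x ∙ acc) h e xs

  fold-↭ : (f : B → A) {xs ys : List B} → xs ↭ ys → fold f xs ≡ fold f ys
  fold-↭ f {xs} {ys} xs↭ys = begin
    fold f xs              ≡⟨ foldr-map _∙_ f e xs ⟨
    foldr _∙_ e (map f xs) ≡⟨ PermutationₛP.foldr-commMonoid (≡.setoid A) isCM (↭⇒↭ₛ (map⁺ f xs↭ys)) ⟩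
    foldr _∙_ e (map f ys) ≡⟨ foldr-map _∙_ f e ys ⟩
    fold f ys              ∎
    where open ≡-Reasoning

  fold-++ : (f : B → A) (xs ys : List B) → fold f (xs ++ ys) ≡ fold f xs ∙ fold f ys
  fold-++ f []       ys = sym (identityˡ _)
  fold-++ f (x ∷ xs) ys = trans (cong (f x ∙_) (fold-++ f xs ys)) (sym (assoc (f x) _ _))

  fold-cong : {f h : B → A} {xs : List B} → All (λ x → f x ≡ h x) xs → fold f xs ≡ fold h xs
  fold-cong []         = refl
  fold-cong (eq ∷ eqs) = cong₂ _∙_ eq (fold-cong eqs)

module ∏ = CommutativeFold ℚP.*-1-isCommutativeMonoid

module ∑ where
  open CommutativeFold ℚP.+-0-isCommutativeMonoid public

  fold-*ˡ : ∀ q (f : B → ℚ) xs → fold (λ x → q *ℚ f x) xs ≡ q *ℚ fold f xs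
  fold-*ˡ q f []       = sym (ℚP.*-zeroʳ q)
  fold-*ˡ q f (x ∷ xs) = trans (cong (q *ℚ f x +ℚ_) (fold-*ˡ q f xs)) (sym (ℚP.*-distribˡ-+ q (f x) _))

  fold-cartesianProduct : (f : A → ℚ) (h : B → ℚ) (xs : List A) (ys : List B) →
    fold (uncurry λ x y → f x *ℚ h y) (cartesianProduct xs ys) ≡ fold f xs *ℚ fold h ys
  fold-cartesianProduct f h []       ys = sym (ℚP.*-zeroˡ (fold h ys))
  fold-cartesianProduct f h (x ∷ xs) ys = begin
    fold F (map (x ,_) ys ++ cartesianProduct xs ys)
      ≡⟨ fold-++ F (map (x ,_) ys) _ ⟩
    fold F (map (x ,_) ys) +ℚ fold F (cartesianProduct xs ys)
      ≡⟨ cong₂ _+ℚ_ (trans (fold-map F (x ,_) ys) (fold-*ˡ (f x) h ys)) (fold-cartesianProduct f h xs ys) ⟩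
    f x *ℚ fold h ys +ℚ fold f xs *ℚ fold h ys
      ≡⟨ ℚP.*-distribʳ-+ (fold h ys) (f x) _ ⟨
    (f x +ℚ fold f xs) *ℚ fold h ys ∎
    where
    open ≡-Reasoning
    F = uncurry λ x y → f x *ℚ h y

unique-map⁺ : (f : A → B) {xs : List A} →
  (∀ {x y} → x ∈ xs → y ∈ xs → f x ≡ f y → x ≡ y) → Unique xs → Unique (map f xs)
unique-map⁺ f inj []           = []
unique-map⁺ f inj (x∉xs ∷ xs!) =
  AllP.map⁺ (All.tabulate (λ y∈xs fx≡fy → All.lookup x∉xs y∈xs (inj (here refl) (there y∈xs) fx≡fy))) ∷
  unique-map⁺ f (λ x∈ y∈ → inj (there x∈) (there y∈)) xs!

Nonincreasing : List ℕ → Set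
Nonincreasing = Linked _≥_

≥-trans : {i j k : ℕ} → i ≥ j → j ≥ k → i ≥ k
≥-trans i≥j j≥k = ≤-trans j≥k i≥j

nonincreasing-↭⇒≡ : Nonincreasing xs → Nonincreasing ys → xs ↭ ys → xs ≡ ys
nonincreasing-↭⇒≡ xs↘ ys↘ xs↭ys =
  Pointwise-≡⇒≡ (↗↭↗⇒≋ (Flip.totalOrder ≤-totalOrder) xs↘ ys↘ (↭⇒↭ₛ xs↭ys))

⊕-nonincreasing : Nonincreasing xs → Nonincreasing ys → Nonincreasing (xs ⊕ ys)
⊕-nonincreasing = merge⁺ (Flip.decTotalOrder ≤-decTotalOrder)

⊕-comm : Nonincreasing xs → Nonincreasing ys → xs ⊕ ys ≡ ys ⊕ xs
⊕-comm {xs} {ys} xs↘ ys↘ = nonincreasing-↭⇒≡ (⊕-nonincreasing xs↘ ys↘) (⊕-nonincreasing ys↘ xs↘) (begin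
  xs ⊕ ys  ↭⟨ merge-↭ _≥?_ xs ys ⟩
  xs ++ ys ↭⟨ ++-comm xs ys ⟩
  ys ++ xs ↭⟨ merge-↭ _≥?_ ys xs ⟨
  ys ⊕ xs  ∎)
  where open PermutationReasoning

⊕-isPartition : IsPartition xs → IsPartition ys → IsPartition (xs ⊕ ys)
⊕-isPartition {xs} {ys} (xs⁺ , xs↘) (ys⁺ , ys↘) =
  All-resp-↭ (↭-sym (merge-↭ _≥?_ xs ys)) (AllP.++⁺ xs⁺ ys⁺) , ⊕-nonincreasing xs↘ ys↘

filter-⊕-↭ : {P : ℕ → Set} (P? : Decidable P) (xs ys : List ℕ) →
  filter P? (xs ⊕ ys) ↭ filter P? xs ++ filter P? ys
filter-⊕-↭ P? xs ys = subst (filter P? (xs ⊕ ys) ↭_) (filter-++ P? xs ys) (filter-↭ P? (merge-↭ _≥?_ xs ys))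

module _ {P : ℕ → Set} (P? : Decidable P) where

  filter-isPartition : IsPartition xs → IsPartition (filter P? xs)
  filter-isPartition (xs⁺ , xs↘) = AllP.filter⁺ P? xs⁺ , LinkedP.filter⁺ P? ≥-trans xs↘

  filter-∁-↭ : ∀ xs → xs ↭ filter P? xs ++ filter (∁? P?) xs
  filter-∁-↭ xs =
    subst (λ (ys , zs) → xs ↭ ys ++ zs) (partition-defn P? xs)
          (↭ₛ⇒↭ (PermutationₛP.partition-↭ (≡.setoid ℕ) P? xs))

  ⊕-filter-∁ : Nonincreasing xs → filter P? xs ⊕ filter (∁? P?) xs ≡ xs
  ⊕-filter-∁ {xs} xs↘ = nonincreasing-↭⇒≡ (⊕-nonincreasing xs↘′ xs↘″) xs↘
    (↭-trans (merge-↭ _≥?_ (filter P? xs) _) (↭-sym (filter-∁-↭ xs)))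
    where
    xs↘′ = LinkedP.filter⁺ P? ≥-trans xs↘
    xs↘″ = LinkedP.filter⁺ (∁? P?) ≥-trans xs↘

  filter-⊕-separated : Nonincreasing xs → Nonincreasing ys → All P xs → All (∁ P) ys →
    filter P? (xs ⊕ ys) ≡ xs × filter (∁? P?) (xs ⊕ ys) ≡ ys
  filter-⊕-separated {xs} {ys} xs↘ ys↘ Pxs ∁Pys =
    nonincreasing-↭⇒≡ (LinkedP.filter⁺ P? ≥-trans xy↘) xs↘ (begin
      filter P? (xs ⊕ ys)          ↭⟨ filter-⊕-↭ P? xs ys ⟩
      filter P? xs ++ filter P? ys ≡⟨ cong₂ _++_ (filter-all P? Pxs) (filter-none P? ∁Pys) ⟩
      xs ++ []                     ≡⟨ ++-identityʳ xs ⟩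
      xs                           ∎) ,
    nonincreasing-↭⇒≡ (LinkedP.filter⁺ (∁? P?) ≥-trans xy↘) ys↘ (begin
      filter (∁? P?) (xs ⊕ ys)               ↭⟨ filter-⊕-↭ (∁? P?) xs ys ⟩
      filter (∁? P?) xs ++ filter (∁? P?) ys ≡⟨ cong₂ _++_ (filter-none (∁? P?) ¬∁Pxs) (filter-all (∁? P?) ∁Pys) ⟩
      ys                                     ∎)
    where
    open PermutationReasoning
    xy↘ = ⊕-nonincreasing xs↘ ys↘
    ¬∁Pxs : All (∁ (∁ P)) xs
    ¬∁Pxs = All.map (λ Px ∁Px → ∁Px Px) Pxs

separated⇒NoCommonPart : {P : ℕ → Set} → All P xs → All (∁ P) ys → NoCommonPart xs ys
separated⇒NoCommonPart Pxs ∁Pys a a∈xs a∈ys = All.lookup ∁Pys a∈ys (All.lookup Pxs a∈xs)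

pμ-⊕ : (x : Fin N → ℚ) (a b : List ℕ) → pμ x (a ⊕ b) ≡ pμ x a *ℚ pμ x b
pμ-⊕ x a b = trans (∏.fold-↭ (pk x) (merge-↭ _≥?_ a b)) (∏.fold-++ (pk x) a b)

neg1^-+ : ∀ m n → neg1^ (m + n) ≡ neg1^ m *ℚ neg1^ n
neg1^-+ zero    n = sym (ℚP.*-identityˡ _)
neg1^-+ (suc m) n = trans (cong -_ (neg1^-+ m n)) (ℚP.neg-distribˡ-* (neg1^ m) _)

signμ-⊕ : (a b : List ℕ) → signμ (a ⊕ b) ≡ signμ a *ℚ signμ b
signμ-⊕ a b = trans (cong neg1^ (begin
  sum (map pred (a ⊕ b))                ≡⟨ sum-↭ (map⁺ pred (merge-↭ _≥?_ a b)) ⟩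
  sum (map pred (a ++ b))               ≡⟨ cong sum (map-++ pred a b) ⟩
  sum (map pred a ++ map pred b)        ≡⟨ sum-++ (map pred a) _ ⟩
  sum (map pred a) + sum (map pred b)   ∎))
  (neg1^-+ (sum (map pred a)) _)
  where open ≡-Reasoning

r-++ : ∀ k xs ys → r k (xs ++ ys) ≡ r k xs + r k ys
r-++ k xs ys = trans (cong length (filter-++ (k ≟_) xs ys)) (length-++ (filter (k ≟_) xs))

r-↭ : ∀ k → xs ↭ ys → r k xs ≡ r k ys
r-↭ k xs↭ys = ↭-length (filter-↭ (k ≟_) xs↭ys)

r-⊕ : ∀ k a b → r k (a ⊕ b) ≡ r k a + r k b
r-⊕ k a b = trans (r-↭ k (merge-↭ _≥?_ a b)) (r-++ k a b)

r-∉ : k ∉ xs → r k xs ≡ 0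
r-∉ {k} {xs} k∉xs = cong length (filter-none (k ≟_) (AllP.¬Any⇒All¬ xs k∉xs))

All≡⇒replicate : All (u ≡_) xs → xs ≡ replicate (length xs) u
All≡⇒replicate []          = refl
All≡⇒replicate (refl ∷ us) = cong (_ ∷_) (All≡⇒replicate us)

filter-≟-replicate : ∀ u xs → filter (u ≟_) xs ≡ rep u (r u xs)
filter-≟-replicate u xs = All≡⇒replicate (AllP.all-filter (u ≟_) xs)

NoCommonPart⇒r≡0 : NoCommonPart a b → ∀ k → r k a ≡ 0 ⊎ r k b ≡ 0
NoCommonPart⇒r≡0 {a} a#b k with k ∈? a
... | yes k∈a = inj₂ (r-∉ (a#b k k∈a))
... | no  k∉a = inj₁ (r-∉ k∉a)

r-filter-≢ : ∀ {u v} → u ≢ v → ∀ xs → r v (filter (∁? (u ≟_)) xs) ≡ r v xs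
r-filter-≢ {u} {v} u≢v xs = sym (begin
  r v xs                                               ≡⟨ r-↭ v (filter-∁-↭ (u ≟_) xs) ⟩
  r v (filter (u ≟_) xs ++ filter (∁? (u ≟_)) xs)       ≡⟨ r-++ v (filter (u ≟_) xs) _ ⟩
  r v (filter (u ≟_) xs) + r v (filter (∁? (u ≟_)) xs) ≡⟨ cong (_+ r v (filter (∁? (u ≟_)) xs)) (r-∉ v∉) ⟩
  r v (filter (∁? (u ≟_)) xs)                          ∎)
  where
  open ≡-Reasoning
  v∉ : v ∉ filter (u ≟_) xs
  v∉ v∈ = u≢v (proj₂ (∈-filter⁻ (u ≟_) {xs = xs} v∈))

∈⇒≤sum : k ∈ xs → k ≤ sum xs
∈⇒≤sum {xs = x ∷ xs} (here refl) = m≤m+n x (sum xs)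
∈⇒≤sum {xs = x ∷ xs} (there k∈xs) = ≤-trans (∈⇒≤sum k∈xs) (m≤n+m (sum xs) x)

zFactor : List ℕ → ℕ → ℕ
zFactor μ a = suc a ^ r (suc a) μ * r (suc a) μ !

zFactors-++ : ∀ μ as bs → zFactors μ (as ++ bs) ≡ zFactors μ as * zFactors μ bs
zFactors-++ μ []       bs = sym (+-identityʳ _)
zFactors-++ μ (a ∷ as) bs = trans (cong (zFactor μ a *_) (zFactors-++ μ as bs)) (sym (*-assoc (zFactor μ a) _ _))

zFactors-upTo : ∀ μ d → zFactors μ (upTo (sum μ + d)) ≡ z μ
zFactors-upTo μ zero    = cong (zFactors μ ∘ upTo) (+-identityʳ (sum μ))
zFactors-upTo μ (suc d) = begin
  zFactors μ (upTo (sum μ + suc d))       ≡⟨ cong (zFactors μ ∘ upTo) (+-suc (sum μ) d) ⟩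
  zFactors μ (upTo (suc t))               ≡⟨ cong (zFactors μ) (upTo-∷ʳ t) ⟨
  zFactors μ (upTo t ∷ʳ t)                ≡⟨ zFactors-++ μ (upTo t) [ t ] ⟩
  zFactors μ (upTo t) * (zFactor μ t * 1) ≡⟨ cong₂ (λ m k → m * (k * 1)) (zFactors-upTo μ d) zFactor-t≡1 ⟩
  z μ * 1                                 ≡⟨ *-identityʳ (z μ) ⟩
  z μ                                     ∎
  where
  open ≡-Reasoning
  t = sum μ + d
  zFactor-t≡1 : zFactor μ t ≡ 1
  zFactor-t≡1 rewrite r-∉ (λ t+1∈μ → <⇒≱ (s≤s (m≤m+n (sum μ) d)) (∈⇒≤sum {xs = μ} t+1∈μ)) = refl

pow-factorial-+ : ∀ c m n → m ≡ 0 ⊎ n ≡ 0 → c ^ (m + n) * (m + n) ! ≡ (c ^ m * m !) * (c ^ n * n !)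
pow-factorial-+ c .0 n (inj₁ refl) = sym (*-identityˡ _)
pow-factorial-+ c m .0 (inj₂ refl) rewrite +-identityʳ m = sym (*-identityʳ _)

zFactors-⊕ : NoCommonPart a b → ∀ ks → zFactors (a ⊕ b) ks ≡ zFactors a ks * zFactors b ks
zFactors-⊕         a#b []       = refl
zFactors-⊕ {a} {b} a#b (k ∷ ks) =
  trans (cong₂ _*_ zFactor-⊕ (zFactors-⊕ a#b ks)) (interchange *-commutativeSemigroup (zFactor a k) _ _ _)
  where
  zFactor-⊕ : zFactor (a ⊕ b) k ≡ zFactor a k * zFactor b k
  zFactor-⊕ = trans (cong (λ m → suc k ^ m * m !) (r-⊕ (suc k) a b))
                    (pow-factorial-+ (suc k) _ _ (NoCommonPart⇒r≡0 a#b (suc k)))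

z-⊕ : NoCommonPart a b → z (a ⊕ b) ≡ z a * z b
z-⊕ {a} {b} a#b = begin
  zFactors (a ⊕ b) (upTo s)                 ≡⟨ zFactors-⊕ a#b (upTo s) ⟩
  zFactors a (upTo s) * zFactors b (upTo s) ≡⟨ cong₂ _*_ (cong (zFactors a ∘ upTo) s≡)
                                                          (cong (zFactors b ∘ upTo) (trans s≡ (+-comm (sum a) (sum b)))) ⟩
  zFactors a (upTo (sum a + sum b)) * zFactors b (upTo (sum b + sum a))
                                            ≡⟨ cong₂ _*_ (zFactors-upTo a (sum b)) (zFactors-upTo b (sum a)) ⟩
  z a * z b                                 ∎
  where
  open ≡-Reasoning
  s = sum (a ⊕ b)
  s≡ : s ≡ sum a + sum b
  s≡ = trans (sum-↭ (merge-↭ _≥?_ a b)) (sum-++ a b)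

-- 1/(m+1) is already the normal form mkℚ 1 m, and ℚ-multiplication normalises (1·1)/((m+1)(n+1)).
1/-* : ∀ m n {k} .{{_ : NonZero m}} .{{_ : NonZero n}} .{{_ : NonZero k}} → k ≡ m * n →
  + 1 /ℚ k ≡ (+ 1 /ℚ m) *ℚ (+ 1 /ℚ n)
1/-* (suc m) (suc n) refl =
  sym (cong₂ _*ℚ_ (ℚP.↥p/↧p≡p (mkℚ (+ 1) m (1-coprimeTo (suc m))))
                  (ℚP.↥p/↧p≡p (mkℚ (+ 1) n (1-coprimeTo (suc n)))))

-- The NonZero argument of _/ℚ_ is irrelevant, so this is definitionally the factor 1/z_μ of term.
1/z : List ℕ → ℚ
1/z μ = _/ℚ_ (+ 1) (z μ) {{zFactors≢0 μ (upTo (sum μ))}}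

1/z-⊕ : NoCommonPart a b → 1/z (a ⊕ b) ≡ 1/z a *ℚ 1/z b
1/z-⊕ {a} {b} a#b =
  1/-* (z a) (z b) {{zFactors≢0 a (upTo (sum a))}} {{zFactors≢0 b (upTo (sum b))}}
       {{zFactors≢0 (a ⊕ b) (upTo (sum (a ⊕ b)))}} (z-⊕ a#b)

term-⊕ : (x : Fin N → ℚ) → NoCommonPart a b → term x (a ⊕ b) ≡ term x a *ℚ term x b
term-⊕ {a = a} {b = b} x a#b = begin
  signμ (a ⊕ b) *ℚ (pμ x (a ⊕ b) *ℚ 1/z (a ⊕ b))
    ≡⟨ cong₂ _*ℚ_ (signμ-⊕ a b) (cong₂ _*ℚ_ (pμ-⊕ x a b) (1/z-⊕ a#b)) ⟩
  (signμ a *ℚ signμ b) *ℚ ((pμ x a *ℚ pμ x b) *ℚ (1/z a *ℚ 1/z b))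
    ≡⟨ cong ((signμ a *ℚ signμ b) *ℚ_) (interchange ℚ-* (pμ x a) (pμ x b) _ _) ⟩
  (signμ a *ℚ signμ b) *ℚ ((pμ x a *ℚ 1/z a) *ℚ (pμ x b *ℚ 1/z b))
    ≡⟨ interchange ℚ-* (signμ a) (signμ b) _ _ ⟩
  term x a *ℚ term x b ∎
  where
  open ≡-Reasoning
  ℚ-* = CommutativeMonoid.commutativeSemigroup ℚP.*-1-commutativeMonoid

module PEquivalence (p : ℕ) .{{_ : NonTrivial p}} where

  private instance
    p≢0 : NonZero p
    p≢0 = nonTrivial⇒nonZero p

  infix 4 _∼_
  _∼_ : List ℕ → List ℕ → Set
  _∼_ = _∼[ p ]_

  -- Fuel a + 1 suffices for a because a / p < a when a > 0 (and 0 / p = 0); see pFreePartWithin-fuel.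
  pFreePartWithin : (fuel : ℕ) → ℕ → ℕ
  pFreePartWithin zero       a = a
  pFreePartWithin (suc fuel) a with p ∣? a
  ... | yes _ = pFreePartWithin fuel (a / p)
  ... | no  _ = a

  pFreePart : ℕ → ℕ
  pFreePart a = pFreePartWithin (suc a) a

  pFreePartWithin-0 : ∀ fuel → pFreePartWithin fuel 0 ≡ 0
  pFreePartWithin-0 zero = refl
  pFreePartWithin-0 (suc fuel) with p ∣? 0
  ... | yes _ = trans (cong (pFreePartWithin fuel) (0/n≡0 p)) (pFreePartWithin-0 fuel)
  ... | no  _ = refl

  /p≤pred : ∀ {a f} → a ≤ suc f → a / p ≤ f
  /p≤pred {zero}  _          = subst (_≤ _) (sym (0/n≡0 p)) z≤n
  /p≤pred {suc a} (s≤s a≤f) = ≤-trans (≤-pred (m/n<m (suc a) p (nonTrivial⇒n>1 p))) a≤f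

  pFreePartWithin-fuel : ∀ {a f f′} → a ≤ f → a ≤ f′ → pFreePartWithin f a ≡ pFreePartWithin f′ a
  pFreePartWithin-fuel {f = zero} {f′}      z≤n _   = sym (pFreePartWithin-0 f′)
  pFreePartWithin-fuel {f = suc f} {zero}   _   z≤n = pFreePartWithin-0 (suc f)
  pFreePartWithin-fuel {a} {suc f} {suc f′} a≤f a≤f′ with p ∣? a
  ... | yes _ = pFreePartWithin-fuel (/p≤pred a≤f) (/p≤pred a≤f′)
  ... | no  _ = refl

  pFreePart-∤ : ¬ p ∣ n → pFreePart n ≡ n
  pFreePart-∤ {n} p∤n with p ∣? n
  ... | yes p∣n = contradiction p∣n p∤n
  ... | no  _   = refl

  pFreePart-p* : ∀ u → pFreePart (p * u) ≡ pFreePart u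
  pFreePart-p* u with p ∣? (p * u)
  ... | yes _   = trans (cong (pFreePartWithin (p * u)) p*u/p≡u) (pFreePartWithin-fuel (m≤n*m u p) (n≤1+n u))
    where
    p*u/p≡u : p * u / p ≡ u
    p*u/p≡u = trans (cong (_/ p) (*-comm p u)) (m*n/n≡m u p)
  ... | no  p∤pu = contradiction (m∣m*n u) p∤pu

  ∼-invariant : (I : List ℕ → Set) → (∀ {a b} → Split p a b → I a ⇔ I b) → a ∼ b → I a ⇔ I b
  ∼-invariant I split⇒⇔ = EqClosure.fold (On.isEquivalence I ⇔-isEquivalence) split⇒⇔

  ∼-isPartition : IsPartition a → a ∼ b → IsPartition b
  ∼-isPartition a⁺ a∼b =
    Equivalence.to (∼-invariant IsPartition (λ (a⁺ , b⁺ , _) → mk⇔ (const b⁺) (const a⁺)) a∼b) a⁺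

  replicate-p⁻ : {P : ℕ → Set} → All P (replicate p u) → P u
  replicate-p⁻ {u} {P} = AllP.replicate⁻ ∘ subst (λ m → All P (replicate m u)) (sym (suc-pred p))

  module _ (F : ℕ → Set) where

    split⇒All-pFreePart⇔ : Split p a b → All (F ∘ pFreePart) a ⇔ All (F ∘ pFreePart) b
    split⇒All-pFreePart⇔ {a} {b} (_ , _ , u , _ , rest , a↭ , b↭) = mk⇔ to from
      where
      to : All (F ∘ pFreePart) a → All (F ∘ pFreePart) b
      to Fa with All-resp-↭ a↭ Fa
      ... | Fpu ∷ Frest = All-resp-↭ (↭-sym b↭) (AllP.++⁺ (AllP.replicate⁺ p (subst F (pFreePart-p* u) Fpu)) Frest)
      from : All (F ∘ pFreePart) b → All (F ∘ pFreePart) a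
      from Fb with AllP.++⁻ (replicate p u) (All-resp-↭ b↭ Fb)
      ... | Fus , Frest = All-resp-↭ (↭-sym a↭) (subst F (sym (pFreePart-p* u)) (replicate-p⁻ Fus) ∷ Frest)

    ∼-All-pFreePart : a ∼ b → All (F ∘ pFreePart) a → All (F ∘ pFreePart) b
    ∼-All-pFreePart a∼b = Equivalence.to (∼-invariant (All (F ∘ pFreePart)) split⇒All-pFreePart⇔ a∼b)

  -- All (const ⊥) holds only for [].
  ∼[]⇒≡[] : [] ∼ b → b ≡ []
  ∼[]⇒≡[] []∼b with ∼-All-pFreePart (const ⊥) []∼b []
  ... | [] = refl

  module _ {F : ℕ → Set} (F? : Decidable F) where

    pFreePart? : Decidable (F ∘ pFreePart)
    pFreePart? = F? ∘ pFreePart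

    -- The part p·u and its p copies of u have the same p-free part, so they are kept or dropped together.
    split⇒filter-∼ : Split p a b → filter pFreePart? a ∼ filter pFreePart? b
    split⇒filter-∼ {a} {b} (a⁺ , b⁺ , u , u≥1 , rest , a↭ , b↭) with F? (pFreePart u)
    ... | yes Fu = EqClosure.return
      (filter-isPartition pFreePart? a⁺ , filter-isPartition pFreePart? b⁺ ,
       u , u≥1 , filter pFreePart? rest , a′↭ , b′↭)
      where
      a′↭ : filter pFreePart? a ↭ p * u ∷ filter pFreePart? rest
      a′↭ = subst (filter pFreePart? a ↭_) (filter-accept pFreePart? (subst F (sym (pFreePart-p* u)) Fu))
                  (filter-↭ pFreePart? a↭)
      b′↭ : filter pFreePart? b ↭ replicate p u ++ filter pFreePart? rest
      b′↭ = subst (filter pFreePart? b ↭_) (trans (filter-++ pFreePart? (replicate p u) rest)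
                                                  (cong (_++ _) (filter-all pFreePart? (AllP.replicate⁺ p Fu))))
                  (filter-↭ pFreePart? b↭)
    ... | no ¬Fu = subst (keep a ∼_) a′≡b′ ε
      where
      open PermutationReasoning
      keep = filter pFreePart?
      a′≡b′ : keep a ≡ keep b
      a′≡b′ = nonincreasing-↭⇒≡ (proj₂ (filter-isPartition pFreePart? a⁺)) (proj₂ (filter-isPartition pFreePart? b⁺))
        (begin
        keep a                                ↭⟨ filter-↭ pFreePart? a↭ ⟩
        keep (p * u ∷ rest)                   ≡⟨ filter-reject pFreePart? (¬Fu ∘ subst F (pFreePart-p* u)) ⟩
        keep rest                             ≡⟨ cong (_++ keep rest) (filter-none pFreePart? (AllP.replicate⁺ p ¬Fu)) ⟨
        keep (replicate p u) ++ keep rest     ≡⟨ filter-++ pFreePart? (replicate p u) rest ⟨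
        keep (replicate p u ++ rest)          ↭⟨ filter-↭ pFreePart? b↭ ⟨
        keep b                                ∎)

    filter-∼ : a ∼ b → filter pFreePart? a ∼ filter pFreePart? b
    filter-∼ = EqClosure.gfold (EqClosure.isEquivalence (Split p)) (filter pFreePart?) split⇒filter-∼

  split-⊕ʳ : IsPartition ν → Split p a b → Split p (a ⊕ ν) (b ⊕ ν)
  split-⊕ʳ {ν} {a} {b} ν⁺ (a⁺ , b⁺ , u , u≥1 , rest , a↭ , b↭) =
    ⊕-isPartition a⁺ ν⁺ , ⊕-isPartition b⁺ ν⁺ , u , u≥1 , rest ++ ν ,
    ↭-trans (merge-↭ _≥?_ a ν) (++⁺ʳ ν a↭) ,
    ↭-trans (merge-↭ _≥?_ b ν) (subst (b ++ ν ↭_) (++-assoc (replicate p u) rest ν) (++⁺ʳ ν b↭))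

  ∼-⊕ʳ : IsPartition ν → a ∼ b → a ⊕ ν ∼ b ⊕ ν
  ∼-⊕ʳ {ν} ν⁺ = EqClosure.gmap (_⊕ ν) (split-⊕ʳ ν⁺)

  ∼-⊕ : ∀ {a a′ b b′} → IsPartition a → IsPartition b → a ∼ a′ → b ∼ b′ → a ⊕ b ∼ a′ ⊕ b′
  ∼-⊕ {a} {a′} {b} {b′} a⁺ b⁺ a∼a′ b∼b′ = begin
    a ⊕ b   ≈⟨ ∼-⊕ʳ b⁺ a∼a′ ⟩
    a′ ⊕ b  ≡⟨ ⊕-comm (proj₂ a′⁺) (proj₂ b⁺) ⟩
    b ⊕ a′  ≈⟨ ∼-⊕ʳ a′⁺ b∼b′ ⟩
    b′ ⊕ a′ ≡⟨ ⊕-comm (proj₂ (∼-isPartition b⁺ b∼b′)) (proj₂ a′⁺) ⟩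
    a′ ⊕ b′ ∎
    where
    open EqReasoning (EqClosure.setoid (Split p))
    a′⁺ = ∼-isPartition a⁺ a∼a′

  module Enumeration (E : List ℕ → List (List ℕ)) (E-enumerates : EnumeratesClasses p E) where

    ∈E⇒∼ : IsPartition λ′ → ν ∈ E λ′ → λ′ ∼ ν
    ∈E⇒∼ {λ′} {ν} λ′⁺ = proj₁ (proj₂ (E-enumerates λ′ λ′⁺) ν)

    ∼⇒∈E : IsPartition λ′ → λ′ ∼ ν → ν ∈ E λ′
    ∼⇒∈E {λ′} {ν} λ′⁺ = proj₂ (proj₂ (E-enumerates λ′ λ′⁺) ν)

    E-isPartition : IsPartition λ′ → ν ∈ E λ′ → IsPartition ν
    E-isPartition λ′⁺ ν∈E = ∼-isPartition λ′⁺ (∈E⇒∼ λ′⁺ ν∈E)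

    E-↭ : {L : List (List ℕ)} → IsPartition λ′ → Unique L → (∀ {ν} → ν ∈ L ⇔ λ′ ∼ ν) → E λ′ ↭ L
    E-↭ {λ′} λ′⁺ L! ∈L⇔∼ = ∼bag⇒↭ (unique∧set⇒bag (proj₁ (E-enumerates λ′ λ′⁺)) L!
      (mk⇔ (Equivalence.from ∈L⇔∼ ∘ ∈E⇒∼ λ′⁺) (∼⇒∈E λ′⁺ ∘ Equivalence.to ∈L⇔∼)))

    g-[] : (x : Fin N → ℚ) → g E [] x ≡ 1ℚ
    g-[] x = ∑.fold-↭ (term x) (E-↭ ([] , []) ([] ∷ [])
      (mk⇔ (λ { (here refl) → ε }) (λ []∼ν → here (∼[]⇒≡[] []∼ν))))

    module _ {λ′ μ} (λ′⁺ : IsPartition λ′) (μ⁺ : IsPartition μ) (λ′∤ : Deprived p λ′) (μ∤ : Deprived p μ)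
             (λ′#μ : NoCommonPart λ′ μ) where

      private
        Q? : Decidable ((_∈ λ′) ∘ pFreePart)
        Q? = pFreePart? (_∈? λ′)

        pairs : List (List ℕ × List ℕ)
        pairs = cartesianProduct (E λ′) (E μ)

      λ′-pFreeParts : All (λ a → pFreePart a ∈ λ′) λ′
      λ′-pFreeParts = All.tabulate λ a∈λ′ → subst (_∈ λ′) (sym (pFreePart-∤ (All.lookup λ′∤ a∈λ′))) a∈λ′

      μ-pFreeParts : All (λ a → pFreePart a ∉ λ′) μ
      μ-pFreeParts = All.tabulate λ {a} a∈μ a′∈λ′ →
        λ′#μ a (subst (_∈ λ′) (pFreePart-∤ (All.lookup μ∤ a∈μ)) a′∈λ′) a∈μ

      pair-separated : {a b : List ℕ} → (a , b) ∈ pairs →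
        All (λ c → pFreePart c ∈ λ′) a × All (λ c → pFreePart c ∉ λ′) b
      pair-separated {a} {b} ab∈pairs with ∈-cartesianProduct⁻ (E λ′) (E μ) ab∈pairs
      ... | a∈E , b∈E = ∼-All-pFreePart (_∈ λ′) (∈E⇒∼ λ′⁺ a∈E) λ′-pFreeParts ,
                        ∼-All-pFreePart (_∉ λ′) (∈E⇒∼ μ⁺ b∈E) μ-pFreeParts

      filter-pair : {a b : List ℕ} → (a , b) ∈ pairs → filter Q? (a ⊕ b) ≡ a × filter (∁? Q?) (a ⊕ b) ≡ b
      filter-pair ab∈pairs with ∈-cartesianProduct⁻ (E λ′) (E μ) ab∈pairs | pair-separated ab∈pairs
      ... | a∈E , b∈E | Qa , ∁Qb =
        filter-⊕-separated Q? (proj₂ (E-isPartition λ′⁺ a∈E)) (proj₂ (E-isPartition μ⁺ b∈E)) Qa ∁Qb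

      ⊕-injective-on-pairs : ∀ {ab a′b′} → ab ∈ pairs → a′b′ ∈ pairs →
        uncurry _⊕_ ab ≡ uncurry _⊕_ a′b′ → ab ≡ a′b′
      ⊕-injective-on-pairs {a , b} {a′ , b′} ab∈ a′b′∈ eq = cong₂ _,_
        (trans (sym (proj₁ (filter-pair ab∈))) (trans (cong (filter Q?) eq) (proj₁ (filter-pair a′b′∈))))
        (trans (sym (proj₂ (filter-pair ab∈))) (trans (cong (filter (∁? Q?)) eq) (proj₂ (filter-pair a′b′∈))))

      ∈⊕pairs⇔∼ : ν ∈ map (uncurry _⊕_) pairs ⇔ λ′ ⊕ μ ∼ ν
      ∈⊕pairs⇔∼ {ν} = mk⇔ to from
        where
        to : ν ∈ map (uncurry _⊕_) pairs → λ′ ⊕ μ ∼ ν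
        to ν∈ with ∈-map⁻ (uncurry _⊕_) ν∈
        ... | _ , ab∈pairs , refl with ∈-cartesianProduct⁻ (E λ′) (E μ) ab∈pairs
        ...   | a∈E , b∈E = ∼-⊕ λ′⁺ μ⁺ (∈E⇒∼ λ′⁺ a∈E) (∈E⇒∼ μ⁺ b∈E)
        from : λ′ ⊕ μ ∼ ν → ν ∈ map (uncurry _⊕_) pairs
        from λ′μ∼ν = subst (_∈ map (uncurry _⊕_) pairs) (⊕-filter-∁ Q? ν↘)
          (∈-map⁺ (uncurry _⊕_) (∈-cartesianProduct⁺ (∼⇒∈E λ′⁺ λ′∼) (∼⇒∈E μ⁺ μ∼)))
          where
          ν↘ = proj₂ (∼-isPartition (⊕-isPartition λ′⁺ μ⁺) λ′μ∼ν)
          λ′μ-separated = filter-⊕-separated Q? (proj₂ λ′⁺) (proj₂ μ⁺) λ′-pFreeParts μ-pFreeParts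
          λ′∼ : λ′ ∼ filter Q? ν
          λ′∼ = subst (_∼ filter Q? ν) (proj₁ λ′μ-separated) (filter-∼ (_∈? λ′) λ′μ∼ν)
          μ∼ : μ ∼ filter (∁? Q?) ν
          μ∼ = subst (_∼ filter (∁? Q?) ν) (proj₂ λ′μ-separated) (filter-∼ (∁? (_∈? λ′)) λ′μ∼ν)

      E-⊕ : E (λ′ ⊕ μ) ↭ map (uncurry _⊕_) pairs
      E-⊕ = E-↭ (⊕-isPartition λ′⁺ μ⁺)
        (unique-map⁺ (uncurry _⊕_) ⊕-injective-on-pairs
          (UniqueP.cartesianProduct⁺ (proj₁ (E-enumerates λ′ λ′⁺)) (proj₁ (E-enumerates μ μ⁺))))
        ∈⊕pairs⇔∼

      g-⊕ : (x : Fin N → ℚ) → g E (λ′ ⊕ μ) x ≡ g E λ′ x *ℚ g E μ x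
      g-⊕ x = begin
        ∑.fold (term x) (E (λ′ ⊕ μ))                        ≡⟨ ∑.fold-↭ (term x) E-⊕ ⟩
        ∑.fold (term x) (map (uncurry _⊕_) pairs)           ≡⟨ ∑.fold-map (term x) (uncurry _⊕_) pairs ⟩
        ∑.fold (term x ∘ uncurry _⊕_) pairs                 ≡⟨ ∑.fold-cong (All.tabulate term-⊕-pair) ⟩
        ∑.fold (uncurry λ a b → term x a *ℚ term x b) pairs
          ≡⟨ ∑.fold-cartesianProduct (term x) (term x) (E λ′) (E μ) ⟩
        g E λ′ x *ℚ g E μ x                                 ∎
        where
        open ≡-Reasoning
        term-⊕-pair : ∀ {ab} → ab ∈ pairs → term x (uncurry _⊕_ ab) ≡ term x (proj₁ ab) *ℚ term x (proj₂ ab)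
        term-⊕-pair ab∈ = term-⊕ x (uncurry separated⇒NoCommonPart (pair-separated ab∈))

    g-split-off : (x : Fin N → ℚ) (u : ℕ) → IsPartition λ′ → Deprived p λ′ →
      g E λ′ x ≡ g E (rep u (r u λ′)) x *ℚ g E (filter (∁? (u ≟_)) λ′) x
    g-split-off {λ′ = λ′} x u λ′⁺ λ′∤ = begin
      g E λ′ x                          ≡⟨ cong (λ ν → g E ν x) (⊕-filter-∁ (u ≟_) (proj₂ λ′⁺)) ⟨
      g E (R ⊕ L) x                     ≡⟨ g-⊕ R⁺ L⁺ R∤ L∤ R#L x ⟩
      g E R x *ℚ g E L x                ≡⟨ cong (λ ν → g E ν x *ℚ g E L x) (filter-≟-replicate u λ′) ⟩
      g E (rep u (r u λ′)) x *ℚ g E L x ∎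
      where
      open ≡-Reasoning
      R = filter (u ≟_) λ′
      L = filter (∁? (u ≟_)) λ′
      R⁺ = filter-isPartition (u ≟_) λ′⁺
      L⁺ = filter-isPartition (∁? (u ≟_)) λ′⁺
      R∤ = AllP.filter⁺ (u ≟_) λ′∤
      L∤ = AllP.filter⁺ (∁? (u ≟_)) λ′∤
      R#L : NoCommonPart R L
      R#L = separated⇒NoCommonPart (AllP.all-filter (u ≟_) λ′) (AllP.all-filter (∁? (u ≟_)) λ′)

    g-product : {U : List ℕ} (x : Fin N → ℚ) → Unique U →
      IsPartition λ′ → Deprived p λ′ → (∀ {a} → a ∈ λ′ → a ∈ U) →
      g E λ′ x ≡ ∏.fold (λ u → g E (rep u (r u λ′)) x) U
    g-product {λ′ = []}    {[]}    x _ _ _ _ = g-[] x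
    g-product {λ′ = a ∷ _} {[]}    x _ _ _ ⊆[] with ⊆[] (here refl)
    ... | ()
    g-product {λ′ = λ′}    {u ∷ U} x (u∉U ∷ U!) λ′⁺ λ′∤ ⊆u∷U = begin
      g E λ′ x                                          ≡⟨ g-split-off x u λ′⁺ λ′∤ ⟩
      gᵤ *ℚ g E L x                                     ≡⟨ cong (gᵤ *ℚ_) (g-product x U! L⁺ L∤ ⊆U) ⟩
      gᵤ *ℚ ∏.fold (λ v → g E (rep v (r v L)) x) U      ≡⟨ cong (gᵤ *ℚ_) (∏.fold-cong factors-agree) ⟩
      gᵤ *ℚ ∏.fold (λ v → g E (rep v (r v λ′)) x) U     ∎
      where
      open ≡-Reasoning
      gᵤ = g E (rep u (r u λ′)) x
      L = filter (∁? (u ≟_)) λ′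
      L⁺ = filter-isPartition (∁? (u ≟_)) λ′⁺
      L∤ = AllP.filter⁺ (∁? (u ≟_)) λ′∤
      ⊆U : ∀ {a} → a ∈ L → a ∈ U
      ⊆U a∈L with ∈-filter⁻ (∁? (u ≟_)) {xs = λ′} a∈L
      ... | a∈λ′ , u≢a with ⊆u∷U a∈λ′
      ...   | here a≡u = contradiction (sym a≡u) u≢a
      ...   | there a∈U = a∈U
      factors-agree : All (λ v → g E (rep v (r v L)) x ≡ g E (rep v (r v λ′)) x) U
      factors-agree = All.map (λ {v} u≢v → cong (λ k → g E (rep v k) x) (r-filter-≢ u≢v λ′)) u∉U

    g-prodG : (x : Fin N → ℚ) → IsPartition λ′ → Deprived p λ′ → g E λ′ x ≡ prodG p E λ′ x
    g-prodG {λ′ = λ′} x λ′⁺ λ′∤ = g-product x U! λ′⁺ λ′∤ ⊆U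
      where
      p∤? = λ u → ¬? (p ∣? u)
      U! = UniqueP.filter⁺ p∤? (UniqueP.map⁺ suc-injective (UniqueP.upTo⁺ (sum λ′)))
      ⊆U : ∀ {a} → a ∈ λ′ → a ∈ filter p∤? (map suc (upTo (sum λ′)))
      ⊆U a∈λ′ with All.lookup (proj₁ λ′⁺) a∈λ′
      ... | s≤s _ = ∈-filter⁺ p∤? (∈-map⁺ suc (∈-upTo⁺ (∈⇒≤sum a∈λ′))) (All.lookup λ′∤ a∈λ′)

lemma5p3 : (p : ℕ) → Prime p →
    (E : List ℕ → List (List ℕ)) → EnumeratesClasses p E →
    ((λ′ μ : List ℕ) → IsPartition λ′ → IsPartition μ →
      Deprived p λ′ → Deprived p μ → NoCommonPart λ′ μ →
      (N : ℕ) (x : Fin N → ℚ) →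
      g E (λ′ ⊕ μ) x ≡ g E λ′ x *ℚ g E μ x)
    ×
    ((λ′ : List ℕ) → IsPartition λ′ → Deprived p λ′ →
      (N : ℕ) (x : Fin N → ℚ) →
      g E λ′ x ≡ prodG p E λ′ x)
lemma5p3 p (prime _) E E-enumerates =
  (λ _ _ λ′⁺ μ⁺ λ′∤ μ∤ λ′#μ _ x → g-⊕ λ′⁺ μ⁺ λ′∤ μ∤ λ′#μ x) ,
  (λ _ λ′⁺ λ′∤ _ x → g-prodG x λ′⁺ λ′∤)
  where open PEquivalence.Enumeration p E E-enumerates
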